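{- There is a transitive automorphism $g$ of the random graph $\mathbf R$ (i.e. $\{g^k\}_{k\in\mathbb Z}$ acts transitively on the vertices of $\mathbf R$) such that for every finite substructure $\mathbf A\subseteq\mathbf R$ there is some $n\in\mathbb N$ such that for all $a\in\mathbf A$ and $b\in g^n.\mathbf A$, $a$ and $b$ are not adjacent in $\mathbf R$.
   Context: The random graph $\mathbf R$ is the unique countable graph (symmetric irreflexive binary relation) such that for all disjoint finite vertex sets $A,B$ there is a vertex adjacent to every element of $A$ and to no element of $B$; equivalently, the Fraïssé limit of the class of finite graphs. -}

module Defs where

open import Data.Nat using (ℕ; zero; suc)
open import Data.Integer using (ℤ; +_; -[1+_])
open import Data.Bool using (Bool; true; false)
open import Data.List using (List; map)
open import Data.List.Membership.Propositional using (_∈_; _∉_)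
open import Data.Product using (Σ; ∃; _×_; _,_)
open import Relation.Binary.PropositionalEquality using (_≡_)

record Graph : Set where
  field
    adj   : ℕ → ℕ → Bool
    sym   : ∀ x y → adj x y ≡ adj y x
    irref : ∀ x → adj x x ≡ false

open Graph public

IsRandom : Graph → Set
IsRandom G = (A B : List ℕ) → (∀ x → x ∈ A → x ∉ B) →
  ∃ λ v → (∀ a → a ∈ A → adj G v a ≡ true) × (∀ b → b ∈ B → adj G v b ≡ false)

record Automorphism (G : Graph) : Set where
  field
    to        : ℕ → ℕ
    from      : ℕ → ℕ
    to-from   : ∀ x → to (from x) ≡ x
    from-to   : ∀ x → from (to x) ≡ x
    preserves : ∀ x y → adj G (to x) (to y) ≡ adj G x y

open Automorphism public

iter : (ℕ → ℕ) → ℕ → ℕ → ℕ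
iter f zero    x = x
iter f (suc n) x = f (iter f n x)

pow : {G : Graph} → Automorphism G → ℤ → ℕ → ℕ
pow g (+ n)      = iter (to g) n
pow g -[1+ n ]   = iter (from g) (suc n)

IsTransitive : {G : Graph} → Automorphism G → Set
IsTransitive g = ∀ x y → ∃ λ (k : ℤ) → pow g k x ≡ y

-- Enumerate the random graph along ℤ so that adjacency depends only on distance:
-- adj (e i) (e j) = T ∣i - j∣ for one profile T : ℕ → Bool; then i ↦ i + 1 becomes a transitive
-- automorphism. When the positions [-L, L] are filled, T is
-- fixed up to 2L only, so the next vertex of R can be put at position 3L + 1: its distances to the
-- filled positions lie in (2L, 4L + 1], and T is defined there to match its adjacencies. The
-- extension property then fills the remaining positions. Since T stays false on (4L + 1, 6L + 2],
-- it has arbitrarily long runs of false, and shifting a finite set so that all its distances to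
-- its image fall into such a run makes it independent from that image.

module Submission where

open import Defs
open import Data.Nat using (ℕ)
open import Data.Integer using (+_)
open import Data.Bool using (false)
open import Data.List using (List; map)
open import Data.List.Membership.Propositional using (_∈_)
open import Data.Product using (Σ; ∃; _×_; _,_)
open import Relation.Binary.PropositionalEquality using (_≡_)

open import Data.Bool using (Bool; true)
import Data.Bool as Bool
open import Data.Empty using (⊥-elim)
import Data.Integer as ℤ
open ℤ using (ℤ; -[1+_]; ∣_∣; 0ℤ; 1ℤ)
import Data.Integer.Properties as ℤ
open import Data.Integer.Tactic.RingSolver using (solve-∀)
import Data.Nat.Tactic.RingSolver as ℕ-Solver
open import Data.List using ([]; _∷_; filter)
open import Data.List.Extrema.Nat using (max; xs≤max)
open import Data.List.Membership.Propositional using (_∉_)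
open import Data.List.Membership.Propositional.Properties using (∈-map⁺; ∈-map⁻; ∈-filter⁺; ∈-filter⁻)
open import Data.List.Relation.Binary.Subset.Propositional using (_⊆_)
import Data.List.Relation.Unary.All as All
open import Data.List.Relation.Unary.Any using (here; there)
open import Data.Nat using (zero; suc; _+_; _≤_; _<_; _≤′_; ≤′-refl; ≤′-step; z≤n; s≤s; _≤?_; _<?_)
import Data.Nat.Properties as ℕ
open import Data.Product using (proj₁; proj₂)
open import Data.Sum using (_⊎_; inj₁; inj₂; [_,_])
open import Function using (_∘_)
open import Relation.Nullary using (yes; no)
open import Relation.Binary.PropositionalEquality as ≡ using (refl; trans; cong; cong₂; subst; _≢_; module ≡-Reasoning)

dist : ℤ → ℤ → ℕ
dist i j = ∣ i ℤ.- j ∣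

dist-sym : ∀ i j → dist i j ≡ dist j i
dist-sym = ℤ.∣i-j∣≡∣j-i∣

dist-self : ∀ i → dist i i ≡ 0
dist-self i = cong ∣_∣ (ℤ.+-inverseʳ i)

dist-0ʳ : ∀ i → dist i 0ℤ ≡ ∣ i ∣
dist-0ʳ i = cong ∣_∣ (ℤ.+-identityʳ i)

dist-translate : ∀ i j k → dist (i ℤ.+ k) (j ℤ.+ k) ≡ dist i j
dist-translate i j k = cong ∣_∣ (cancel i j k)
  where
  cancel : ∀ i j k → (i ℤ.+ k) ℤ.- (j ℤ.+ k) ≡ i ℤ.- j
  cancel = solve-∀

dist-+ʳ : ∀ i n → dist i (i ℤ.+ + n) ≡ n
dist-+ʳ i n = trans (cong ∣_∣ (cancel i (+ n))) (ℤ.∣-i∣≡∣i∣ (+ n))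
  where
  cancel : ∀ i k → i ℤ.- (i ℤ.+ k) ≡ ℤ.- k
  cancel = solve-∀

dist-triangle : ∀ i j k → dist i k ≤ dist i j + dist j k
dist-triangle i j k =
  subst (λ z → ∣ z ∣ ≤ dist i j + dist j k) (split i j k) (ℤ.∣i+j∣≤∣i∣+∣j∣ (i ℤ.- j) (j ℤ.- k))
  where
  split : ∀ i j k → (i ℤ.- j) ℤ.+ (j ℤ.- k) ≡ i ℤ.- k
  split = solve-∀

dist-bounded : ∀ {M} i j → ∣ i ∣ ≤ M → ∣ j ∣ ≤ M → dist i j ≤ M + M
dist-bounded i j ∣i∣≤M ∣j∣≤M = ℕ.≤-trans (ℤ.∣i-j∣≤∣i∣+∣j∣ i j) (ℕ.+-mono-≤ ∣i∣≤M ∣j∣≤M)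

dist-translate-bounds : ∀ {M} i j n → ∣ i ∣ ≤ M → ∣ j ∣ ≤ M →
  n ≤ (M + M) + dist i (j ℤ.+ + n) × dist i (j ℤ.+ + n) ≤ (M + M) + n
dist-translate-bounds {M} i j n ∣i∣≤M ∣j∣≤M = lower , upper
  where
  open ℕ.≤-Reasoning
  lower : n ≤ (M + M) + dist i (j ℤ.+ + n)
  lower = begin
    n                                  ≡⟨ dist-+ʳ j n ⟨
    dist j (j ℤ.+ + n)                 ≤⟨ dist-triangle j i (j ℤ.+ + n) ⟩
    dist j i + dist i (j ℤ.+ + n)      ≤⟨ ℕ.+-monoˡ-≤ _ (dist-bounded j i ∣j∣≤M ∣i∣≤M) ⟩
    (M + M) + dist i (j ℤ.+ + n)       ∎
  upper : dist i (j ℤ.+ + n) ≤ (M + M) + n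
  upper = begin
    dist i (j ℤ.+ + n)                 ≤⟨ dist-triangle i j (j ℤ.+ + n) ⟩
    dist i j + dist j (j ℤ.+ + n)      ≡⟨ cong (λ m → dist i j + m) (dist-+ʳ j n) ⟩
    dist i j + n                       ≤⟨ ℕ.+-monoˡ-≤ n (dist-bounded i j ∣i∣≤M ∣j∣≤M) ⟩
    (M + M) + n                        ∎

i≤+∣i∣ : ∀ i → i ℤ.≤ + ∣ i ∣
i≤+∣i∣ (+ n)    = ℤ.≤-refl
i≤+∣i∣ -[1+ n ] = ℤ.-≤+

dist-inverse : ∀ n q → ∣ q ∣ ≤ n → + n ℤ.- + dist (+ n) q ≡ q
dist-inverse n q ∣q∣≤n = begin
  + n ℤ.- + ∣ + n ℤ.- q ∣   ≡⟨ cong (λ k → + n ℤ.- k) (ℤ.0≤i⇒+∣i∣≡i (ℤ.i≤j⇒0≤j-i q≤n)) ⟩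
  + n ℤ.- (+ n ℤ.- q)       ≡⟨ cancel (+ n) q ⟩
  q                         ∎
  where
  open ≡-Reasoning
  q≤n : q ℤ.≤ + n
  q≤n = ℤ.≤-trans (i≤+∣i∣ q) (ℤ.+≤+ ∣q∣≤n)
  cancel : ∀ i j → i ℤ.- (i ℤ.- j) ≡ j
  cancel = solve-∀

dist-near : ∀ {L} n q → ∣ q ∣ ≤ L → dist (+ n) q ≤ n + L
dist-near n q ∣q∣≤L = ℕ.≤-trans (ℤ.∣i-j∣≤∣i∣+∣j∣ (+ n) q) (ℕ.+-monoʳ-≤ n ∣q∣≤L)

dist-far : ∀ {L} n q → ∣ q ∣ ≤ L → n ≤ dist (+ n) q + L
dist-far {L} n q ∣q∣≤L = begin
  n                          ≡⟨ dist-0ʳ (+ n) ⟨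
  dist (+ n) 0ℤ              ≤⟨ dist-triangle (+ n) q 0ℤ ⟩
  dist (+ n) q + dist q 0ℤ   ≡⟨ cong (λ m → dist (+ n) q + m) (dist-0ʳ q) ⟩
  dist (+ n) q + ∣ q ∣       ≤⟨ ℕ.+-monoʳ-≤ (dist (+ n) q) ∣q∣≤L ⟩
  dist (+ n) q + L           ∎
  where open ℕ.≤-Reasoning

ball : ℕ → List ℤ
ball zero    = 0ℤ ∷ []
ball (suc K) = + suc K ∷ -[1+ K ] ∷ ball K

∈-ball⁺ : ∀ K {q} → ∣ q ∣ ≤ K → q ∈ ball K
∈-ball⁺ zero    {+ zero}    _ = here refl
∈-ball⁺ (suc K) {+ n}       ∣q∣≤K with n ℕ.≟ suc K
... | yes refl = here refl
... | no  n≢K  = there (there (∈-ball⁺ K (ℕ.≤-pred (ℕ.≤∧≢⇒< ∣q∣≤K n≢K))))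
∈-ball⁺ (suc K) { -[1+ n ]} ∣q∣≤K with n ℕ.≟ K
... | yes refl = there (here refl)
... | no  n≢K  = there (there (∈-ball⁺ K (ℕ.≤∧≢⇒< (ℕ.≤-pred ∣q∣≤K) n≢K)))

∈-ball⁻ : ∀ K {q} → q ∈ ball K → ∣ q ∣ ≤ K
∈-ball⁻ zero    (here refl)         = z≤n
∈-ball⁻ (suc K) (here refl)         = ℕ.≤-refl
∈-ball⁻ (suc K) (there (here refl)) = ℕ.≤-refl
∈-ball⁻ (suc K) (there (there q∈))  = ℕ.m≤n⇒m≤1+n (∈-ball⁻ K q∈)

update : ℤ → ℕ → (ℤ → ℕ) → ℤ → ℕ
update p v f i with i ℤ.≟ p
... | yes _ = v
... | no  _ = f i

update-≡ : ∀ p v f → update p v f p ≡ v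
update-≡ p v f with p ℤ.≟ p
... | yes _   = refl
... | no  p≢p = ⊥-elim (p≢p refl)

update-∉ : ∀ {p v f q xs} → p ∉ xs → q ∈ xs → update p v f q ≡ f q
update-∉ {p} {q = q} p∉xs q∈xs with q ℤ.≟ p
... | yes refl = ⊥-elim (p∉xs q∈xs)
... | no  _    = refl

override : ℕ → ℕ → (ℕ → Bool) → (ℕ → Bool) → ℕ → Bool
override lo hi g T d with lo <? d | d ≤? hi
... | yes _ | yes _ = g d
... | _     | _     = T d

override-inside : ∀ {lo hi g T d} → lo < d → d ≤ hi → override lo hi g T d ≡ g d
override-inside {lo} {hi} {d = d} lo<d d≤hi with lo <? d | d ≤? hi
... | yes _   | yes _   = refl
... | yes _   | no  d≰hi = ⊥-elim (d≰hi d≤hi)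
... | no lo≮d | _        = ⊥-elim (lo≮d lo<d)

override-below : ∀ {lo hi g T d} → d ≤ lo → override lo hi g T d ≡ T d
override-below {lo} {hi} {d = d} d≤lo with lo <? d | d ≤? hi
... | yes lo<d | yes _ = ⊥-elim (ℕ.<⇒≱ lo<d d≤lo)
... | yes _    | no  _ = refl
... | no  _    | _     = refl

override-above : ∀ {lo hi g T d} → hi < d → override lo hi g T d ≡ T d
override-above {lo} {hi} {d = d} hi<d with lo <? d | d ≤? hi
... | yes _ | yes d≤hi = ⊥-elim (ℕ.<⇒≱ hi<d d≤hi)
... | yes _ | no  _    = refl
... | no  _ | _        = refl

record DistanceEnumeration (G : Graph) : Set where
  field
    enum       : ℤ → ℕ
    index      : ℕ → ℤ
    enum-index : ∀ x → enum (index x) ≡ x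
    index-enum : ∀ i → index (enum i) ≡ i
    profile    : ℕ → Bool
    adj-enum   : ∀ i j → adj G (enum i) (enum j) ≡ profile (dist i j)

HasLongGaps : (ℕ → Bool) → Set
HasLongGaps T = ∀ w → ∃ λ c → ∀ {d} → c ≤ d → d ≤ w + c → T d ≡ false

module Shift {G : Graph} (E : DistanceEnumeration G) where
  open DistanceEnumeration E
  open ≡-Reasoning

  enum-index-+ : ∀ i k → enum (index (enum i) ℤ.+ k) ≡ enum (i ℤ.+ k)
  enum-index-+ i k = cong (λ j → enum (j ℤ.+ k)) (index-enum i)

  shift : Automorphism G
  shift = record
    { to        = λ x → enum (index x ℤ.+ 1ℤ)
    ; from      = λ x → enum (index x ℤ.- 1ℤ)
    ; to-from   = λ x → begin
        enum (index (enum (index x ℤ.- 1ℤ)) ℤ.+ 1ℤ)  ≡⟨ enum-index-+ (index x ℤ.- 1ℤ) 1ℤ ⟩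
        enum (index x ℤ.- 1ℤ ℤ.+ 1ℤ)                ≡⟨ cong enum (cancel-+ (index x)) ⟩
        enum (index x)                              ≡⟨ enum-index x ⟩
        x                                           ∎
    ; from-to   = λ x → begin
        enum (index (enum (index x ℤ.+ 1ℤ)) ℤ.- 1ℤ)  ≡⟨ enum-index-+ (index x ℤ.+ 1ℤ) (ℤ.- 1ℤ) ⟩
        enum (index x ℤ.+ 1ℤ ℤ.- 1ℤ)                ≡⟨ cong enum (cancel-- (index x)) ⟩
        enum (index x)                              ≡⟨ enum-index x ⟩
        x                                           ∎
    ; preserves = λ x y → begin
        adj G (enum (index x ℤ.+ 1ℤ)) (enum (index y ℤ.+ 1ℤ))  ≡⟨ adj-enum _ _ ⟩
        profile (dist (index x ℤ.+ 1ℤ) (index y ℤ.+ 1ℤ))       ≡⟨ cong profile (dist-translate (index x) (index y) 1ℤ) ⟩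
        profile (dist (index x) (index y))                     ≡⟨ adj-enum (index x) (index y) ⟨
        adj G (enum (index x)) (enum (index y))                ≡⟨ cong₂ (adj G) (enum-index x) (enum-index y) ⟩
        adj G x y                                              ∎
    }
    where
    cancel-+ : ∀ i → i ℤ.- 1ℤ ℤ.+ 1ℤ ≡ i
    cancel-+ = solve-∀
    cancel-- : ∀ i → i ℤ.+ 1ℤ ℤ.- 1ℤ ≡ i
    cancel-- = solve-∀

  iter-to : ∀ n i → iter (to shift) n (enum i) ≡ enum (i ℤ.+ + n)
  iter-to zero    i = cong enum (≡.sym (ℤ.+-identityʳ i))
  iter-to (suc n) i = begin
    to shift (iter (to shift) n (enum i))  ≡⟨ cong (to shift) (iter-to n i) ⟩
    to shift (enum (i ℤ.+ + n))            ≡⟨ enum-index-+ (i ℤ.+ + n) 1ℤ ⟩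
    enum (i ℤ.+ + n ℤ.+ 1ℤ)                ≡⟨ cong enum (reassoc i (+ n)) ⟩
    enum (i ℤ.+ + suc n)                   ∎
    where
    reassoc : ∀ i j → i ℤ.+ j ℤ.+ 1ℤ ≡ i ℤ.+ (1ℤ ℤ.+ j)
    reassoc = solve-∀

  iter-from : ∀ n i → iter (from shift) n (enum i) ≡ enum (i ℤ.- + n)
  iter-from zero    i = cong enum (≡.sym (ℤ.+-identityʳ i))
  iter-from (suc n) i = begin
    from shift (iter (from shift) n (enum i))  ≡⟨ cong (from shift) (iter-from n i) ⟩
    from shift (enum (i ℤ.- + n))              ≡⟨ enum-index-+ (i ℤ.- + n) (ℤ.- 1ℤ) ⟩
    enum (i ℤ.- + n ℤ.- 1ℤ)                    ≡⟨ cong enum (reassoc i (+ n)) ⟩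
    enum (i ℤ.- + suc n)                       ∎
    where
    reassoc : ∀ i j → i ℤ.- j ℤ.- 1ℤ ≡ i ℤ.- (1ℤ ℤ.+ j)
    reassoc = solve-∀

  pow-shift : ∀ k i → pow shift k (enum i) ≡ enum (i ℤ.+ k)
  pow-shift (+ n)    = iter-to n
  pow-shift -[1+ n ] = iter-from (suc n)

  shift-transitive : IsTransitive shift
  shift-transitive x y = index y ℤ.- index x , (begin
    pow shift k x                   ≡⟨ cong (pow shift k) (enum-index x) ⟨
    pow shift k (enum (index x))    ≡⟨ pow-shift k (index x) ⟩
    enum (index x ℤ.+ k)            ≡⟨ cong enum (cancel (index x) (index y)) ⟩
    enum (index y)                  ≡⟨ enum-index y ⟩
    y                               ∎)
    where
    k = index y ℤ.- index x
    cancel : ∀ i j → i ℤ.+ (j ℤ.- i) ≡ j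
    cancel = solve-∀

  -- With the positions of A in [-M, M], the shift n = 2M + c moves every distance into the gap [c, c + 4M].
  shift-separates : HasLongGaps profile → (A : List ℕ) → ∃ λ (n : ℕ) →
    ∀ a b → a ∈ A → b ∈ map (pow shift (+ n)) A → adj G a b ≡ false
  shift-separates gaps A = (M + M) + c , separated
    where
    M = max 0 (map (∣_∣ ∘ index) A)
    c = proj₁ (gaps ((M + M) + (M + M)))
    n = (M + M) + c
    bounded : ∀ {a} → a ∈ A → ∣ index a ∣ ≤ M
    bounded a∈A = All.lookup (xs≤max 0 _) (∈-map⁺ (∣_∣ ∘ index) a∈A)
    separated : ∀ a b → a ∈ A → b ∈ map (pow shift (+ n)) A → adj G a b ≡ false
    separated a b a∈A b∈A+n with ∈-map⁻ (pow shift (+ n)) b∈A+n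
    ... | a′ , a′∈A , refl = begin
      adj G a (pow shift (+ n) a′)                   ≡⟨ cong₂ (adj G) (enum-index a) (cong (pow shift (+ n)) (enum-index a′)) ⟨
      adj G (enum i) (pow shift (+ n) (enum j))      ≡⟨ cong (adj G (enum i)) (pow-shift (+ n) j) ⟩
      adj G (enum i) (enum (j ℤ.+ + n))              ≡⟨ adj-enum i (j ℤ.+ + n) ⟩
      profile (dist i (j ℤ.+ + n))                   ≡⟨ proj₂ (gaps ((M + M) + (M + M))) c≤d d≤w+c ⟩
      false                                          ∎
      where
      i = index a
      j = index a′
      bounds = dist-translate-bounds i j n (bounded a∈A) (bounded a′∈A)
      c≤d : c ≤ dist i (j ℤ.+ + n)
      c≤d = ℕ.+-cancelˡ-≤ (M + M) _ _ (proj₁ bounds)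
      d≤w+c : dist i (j ℤ.+ + n) ≤ (M + M) + (M + M) + c
      d≤w+c = subst (dist i (j ℤ.+ + n) ≤_) (≡.sym (ℕ.+-assoc (M + M) (M + M) c)) (proj₂ bounds)

module PartialEmbeddings (R : Graph) where

  record PartialEmbedding (T : ℕ → Bool) : Set where
    field
      emb           : ℤ → ℕ
      dom           : List ℤ
      adj-emb       : ∀ {i j} → i ∈ dom → j ∈ dom → adj R (emb i) (emb j) ≡ T (dist i j)
      emb-injective : ∀ {i j} → i ∈ dom → j ∈ dom → emb i ≡ emb j → i ≡ j

    image : List ℕ
    image = map emb dom

  open PartialEmbedding public

  record _⊑_ {T T′} (a : PartialEmbedding T) (b : PartialEmbedding T′) : Set where
    field
      dom-⊆ : dom a ⊆ dom b
      emb-≡ : ∀ {i} → i ∈ dom a → emb b i ≡ emb a i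

  open _⊑_ public

  ⊑-refl : ∀ {T} {a : PartialEmbedding T} → a ⊑ a
  ⊑-refl = record { dom-⊆ = λ i∈ → i∈ ; emb-≡ = λ _ → refl }

  ⊑-trans : ∀ {T T′ T″} {a : PartialEmbedding T} {b : PartialEmbedding T′} {c : PartialEmbedding T″} →
            a ⊑ b → b ⊑ c → a ⊑ c
  ⊑-trans a⊑b b⊑c = record
    { dom-⊆ = λ i∈ → dom-⊆ b⊑c (dom-⊆ a⊑b i∈)
    ; emb-≡ = λ i∈ → trans (emb-≡ b⊑c (dom-⊆ a⊑b i∈)) (emb-≡ a⊑b i∈)
    }

  ⊑-image : ∀ {T T′} {a : PartialEmbedding T} {b : PartialEmbedding T′} → a ⊑ b → image a ⊆ image b
  ⊑-image {a = a} {b} a⊑b x∈ with ∈-map⁻ (emb a) x∈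
  ... | i , i∈ , refl = subst (_∈ image b) (emb-≡ a⊑b i∈) (∈-map⁺ (emb b) (dom-⊆ a⊑b i∈))

  profile-0 : ∀ {T i} (a : PartialEmbedding T) → i ∈ dom a → T 0 ≡ false
  profile-0 {T} {i} a i∈ = begin
    T 0                       ≡⟨ cong T (dist-self i) ⟨
    T (dist i i)              ≡⟨ adj-emb a i∈ i∈ ⟨
    adj R (emb a i) (emb a i) ≡⟨ irref R (emb a i) ⟩
    false                     ∎
    where open ≡-Reasoning

  retarget : ∀ {T T′} (a : PartialEmbedding T) →
             (∀ {i j} → i ∈ dom a → j ∈ dom a → T (dist i j) ≡ T′ (dist i j)) → PartialEmbedding T′
  retarget a agree = record
    { emb           = emb a
    ; dom           = dom a
    ; adj-emb       = λ i∈ j∈ → trans (adj-emb a i∈ j∈) (agree i∈ j∈)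
    ; emb-injective = emb-injective a
    }

  retarget-⊒ : ∀ {T T′} (a : PartialEmbedding T)
               (agree : ∀ {i j} → i ∈ dom a → j ∈ dom a → T (dist i j) ≡ T′ (dist i j)) →
               a ⊑ retarget {T′ = T′} a agree
  retarget-⊒ a agree = record { dom-⊆ = λ i∈ → i∈ ; emb-≡ = λ _ → refl }

  record Placement {T} (a : PartialEmbedding T) (p : ℤ) : Set where
    field
      vertex     : ℕ
      fresh      : vertex ∉ image a
      adj-vertex : ∀ {q} → q ∈ dom a → adj R vertex (emb a q) ≡ T (dist p q)

  open Placement public

  module _ {T} (a : PartialEmbedding T) {p} (T0 : T 0 ≡ false) (p∉ : p ∉ dom a) (x : Placement a p) where

    private
      emb′ = update p (vertex x) (emb a)

      emb′-old : ∀ {q} → q ∈ dom a → emb′ q ≡ emb a q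
      emb′-old = update-∉ p∉

      emb′-new : emb′ p ≡ vertex x
      emb′-new = update-≡ p (vertex x) (emb a)

      vertex-≢ : ∀ {q} → q ∈ dom a → vertex x ≢ emb a q
      vertex-≢ q∈ x≡ = fresh x (subst (_∈ image a) (≡.sym x≡) (∈-map⁺ (emb a) q∈))

    extend : PartialEmbedding T
    extend = record
      { emb           = emb′
      ; dom           = p ∷ dom a
      ; adj-emb       = adj-emb′
      ; emb-injective = injective
      }
      where
      adj-emb′ : ∀ {i j} → i ∈ p ∷ dom a → j ∈ p ∷ dom a → adj R (emb′ i) (emb′ j) ≡ T (dist i j)
      adj-emb′ (here refl) (here refl) = begin
        adj R (emb′ p) (emb′ p)          ≡⟨ cong₂ (adj R) emb′-new emb′-new ⟩
        adj R (vertex x) (vertex x)      ≡⟨ irref R (vertex x) ⟩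
        false                            ≡⟨ T0 ⟨
        T 0                              ≡⟨ cong T (dist-self p) ⟨
        T (dist p p)                     ∎
        where open ≡-Reasoning
      adj-emb′ (here refl) (there j∈) =
        trans (cong₂ (adj R) emb′-new (emb′-old j∈)) (adj-vertex x j∈)
      adj-emb′ {i} (there i∈) (here refl) =
        trans (cong₂ (adj R) (emb′-old i∈) emb′-new)
              (trans (sym R (emb a i) (vertex x)) (trans (adj-vertex x i∈) (cong T (dist-sym p i))))
      adj-emb′ (there i∈) (there j∈) =
        trans (cong₂ (adj R) (emb′-old i∈) (emb′-old j∈)) (adj-emb a i∈ j∈)

      injective : ∀ {i j} → i ∈ p ∷ dom a → j ∈ p ∷ dom a → emb′ i ≡ emb′ j → i ≡ j
      injective (here refl) (here refl) _ = refl
      injective (here refl) (there j∈) e =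
        ⊥-elim (vertex-≢ j∈ (trans (≡.sym emb′-new) (trans e (emb′-old j∈))))
      injective (there i∈) (here refl) e =
        ⊥-elim (vertex-≢ i∈ (trans (≡.sym emb′-new) (trans (≡.sym e) (emb′-old i∈))))
      injective (there i∈) (there j∈) e =
        emb-injective a i∈ j∈ (trans (≡.sym (emb′-old i∈)) (trans e (emb′-old j∈)))

    extend-⊒ : a ⊑ extend
    extend-⊒ = record { dom-⊆ = there ; emb-≡ = emb′-old }

    extend-places : vertex x ∈ image extend
    extend-places = subst (_∈ image extend) emb′-new (∈-map⁺ emb′ p∈)
      where
      p∈ : p ∈ p ∷ dom a
      p∈ = here refl

module Construction (R : Graph) (random : IsRandom R) where
  open PartialEmbeddings R
  open import Data.List.Membership.DecPropositional ℤ._≟_ using () renaming (_∈?_ to _∈ℤ?_)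
  open import Data.List.Membership.DecPropositional ℕ._≟_ using () renaming (_∈?_ to _∈ℕ?_)

  adjacent-to-all : (vs : List ℕ) → ∃ λ u → ∀ w → w ∈ vs → adj R u w ≡ true
  adjacent-to-all vs with random vs [] (λ _ _ ())
  ... | u , adj-u , _ = u , adj-u

  adj⇒≢ : ∀ {u w} → adj R u w ≡ true → u ≢ w
  adj⇒≢ {u} adj-uw refl with () ← trans (≡.sym (irref R u)) adj-uw

  -- The new vertex is made non-adjacent to a vertex u adjacent to the whole family, which forces it to be fresh.
  realize : ∀ {A : Set} (xs : List A) (f : A → ℕ) (χ : A → Bool) →
            (∀ {a b} → a ∈ xs → b ∈ xs → f a ≡ f b → χ a ≡ χ b) →
            ∃ λ v → v ∉ map f xs × (∀ {a} → a ∈ xs → adj R v (f a) ≡ χ a)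
  realize xs f χ consistent = v , v-fresh , v-adj
    where
    u      = proj₁ (adjacent-to-all (map f xs))
    adj-u  = proj₂ (adjacent-to-all (map f xs))
    true?  = λ a → χ a Bool.≟ true
    false? = λ a → χ a Bool.≟ false
    As = map f (filter true? xs)
    Bs = u ∷ map f (filter false? xs)

    disjoint : ∀ w → w ∈ As → w ∉ Bs
    disjoint w w∈As w∈Bs with ∈-map⁻ f w∈As
    ... | a , a∈ , refl with ∈-filter⁻ true? a∈ | w∈Bs
    ...   | a∈xs , _ | here fa≡u = adj⇒≢ (adj-u (f a) (∈-map⁺ f a∈xs)) (≡.sym fa≡u)
    ...   | a∈xs , χa | there fa∈ with ∈-map⁻ f fa∈
    ...     | b , b∈ , fa≡fb with ∈-filter⁻ false? b∈
    ...       | b∈xs , χb with () ← trans (≡.sym χa) (trans (consistent a∈xs b∈xs fa≡fb) χb)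

    v     = proj₁ (random As Bs disjoint)
    v-As  = proj₁ (proj₂ (random As Bs disjoint))
    v-Bs  = proj₂ (proj₂ (random As Bs disjoint))

    v-fresh : v ∉ map f xs
    v-fresh v∈ with () ← trans (≡.sym (v-Bs u (here refl))) (trans (sym R v u) (adj-u v v∈))

    v-adj : ∀ {a} → a ∈ xs → adj R v (f a) ≡ χ a
    v-adj {a} a∈ with χ a in χa
    ... | true  = v-As (f a) (∈-map⁺ f (∈-filter⁺ true? a∈ χa))
    ... | false = v-Bs (f a) (there (∈-map⁺ f (∈-filter⁺ false? a∈ χa)))

  placement : ∀ {T} (a : PartialEmbedding T) p → Placement a p
  placement {T} a p with realize (dom a) (emb a) (λ q → T (dist p q))
                                 (λ i∈ j∈ e → cong (λ q → T (dist p q)) (emb-injective a i∈ j∈ e))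
  ... | v , v-fresh , v-adj = record { vertex = v ; fresh = v-fresh ; adj-vertex = v-adj }

  record Completion {T} (a : PartialEmbedding T) (qs : List ℤ) : Set where
    field
      completed : PartialEmbedding T
      extends   : a ⊑ completed
      covers    : qs ⊆ dom completed
      within    : ∀ {q} → q ∈ dom completed → q ∈ dom a ⊎ q ∈ qs

  open Completion

  completion-∷ : ∀ {T} {a b : PartialEmbedding T} {p qs} →
                 a ⊑ b → p ∈ dom b → dom b ⊆ p ∷ dom a → Completion b qs → Completion a (p ∷ qs)
  completion-∷ {a = a} {b} {p} {qs} a⊑b p∈ b⊆ c = record
    { completed = completed c
    ; extends   = ⊑-trans a⊑b (extends c)
    ; covers    = λ { (here refl) → dom-⊆ (extends c) p∈ ; (there q∈) → covers c q∈ }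
    ; within    = within′
    }
    where
    within′ : ∀ {q} → q ∈ dom (completed c) → q ∈ dom a ⊎ q ∈ p ∷ qs
    within′ q∈ with within c q∈
    ... | inj₂ q∈qs = inj₂ (there q∈qs)
    ... | inj₁ q∈b with b⊆ q∈b
    ...   | here q≡p  = inj₂ (here q≡p)
    ...   | there q∈a = inj₁ q∈a

  complete : ∀ {T} → T 0 ≡ false → (a : PartialEmbedding T) (qs : List ℤ) → Completion a qs
  complete T0 a [] = record { completed = a ; extends = ⊑-refl ; covers = λ () ; within = inj₁ }
  complete T0 a (p ∷ qs) with p ∈ℤ? dom a
  ... | yes p∈ = completion-∷ ⊑-refl p∈ there (complete T0 a qs)
  ... | no  p∉ = completion-∷ (extend-⊒ a T0 p∉ x) (here refl) (λ q∈ → q∈) (complete T0 (extend a T0 p∉ x) qs)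
    where x = placement a p

  record Stage : Set where
    field
      level            : ℕ
      profile          : ℕ → Bool
      embedding        : PartialEmbedding profile
      profile-vanishes : ∀ {d} → level + level < d → profile d ≡ false
      dom-bounded      : ∀ {q} → q ∈ dom embedding → ∣ q ∣ ≤ level
      dom-covers       : ∀ {q} → ∣ q ∣ ≤ level → q ∈ dom embedding

  module _ {T} (L : ℕ) (a : PartialEmbedding T) (T0 : T 0 ≡ false)
           (vanishes : ∀ {d} → L + L < d → T d ≡ false) (bounded : ∀ {q} → q ∈ dom a → ∣ q ∣ ≤ L) where

    private
      c = complete T0 a (ball L)

    close : Stage
    close = record
      { level            = L
      ; profile          = T
      ; embedding        = completed c
      ; profile-vanishes = vanishes
      ; dom-bounded      = λ q∈ → [ bounded , ∈-ball⁻ L ] (within c q∈)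
      ; dom-covers       = λ ∣q∣≤L → covers c (∈-ball⁺ L ∣q∣≤L)
      }

    close-⊒ : a ⊑ Stage.embedding close
    close-⊒ = extends c

  empty : ∀ {T} → PartialEmbedding T
  empty = record { emb = λ _ → 0 ; dom = [] ; adj-emb = λ () ; emb-injective = λ () }

  initial : Stage
  initial = close {T = λ _ → false} 0 empty refl (λ _ → refl) (λ ())

  fresh-vertex : (vs : List ℕ) → ∃ λ u → u ∉ vs
  fresh-vertex vs with adjacent-to-all vs
  ... | u , adj-u = u , λ u∈ → adj⇒≢ (adj-u u u∈) refl

  next-level : ℕ → ℕ
  next-level L = suc (L + L) + L

  <-next-level : ∀ L → L < next-level L
  <-next-level L = ℕ.≤-trans (s≤s (ℕ.m≤m+n L L)) (ℕ.m≤m+n (suc (L + L)) L)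

  ≤-next-level : ∀ L → L ≤ next-level L
  ≤-next-level L = ℕ.<⇒≤ (<-next-level L)

  next-level-double : ∀ L → (L + L) + suc (next-level L + L) ≡ next-level L + next-level L
  next-level-double = unfolded
    where
    unfolded : ∀ L → (L + L) + suc ((suc (L + L) + L) + L) ≡ (suc (L + L) + L) + (suc (L + L) + L)
    unfolded = ℕ-Solver.solve-∀

  module Step (s : ℕ) (S : Stage) where
    open Stage S
    open ≡-Reasoning

    L′ : ℕ
    L′ = next-level level

    P : ℤ
    P = + L′

    target : ∃ λ x → x ∉ image embedding × (s ∈ image embedding ⊎ x ≡ s)
    target with s ∈ℕ? image embedding
    ... | yes s∈ = proj₁ (fresh-vertex (image embedding)) , proj₂ (fresh-vertex (image embedding)) , inj₁ s∈
    ... | no  s∉ = s , s∉ , inj₂ refl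

    x : ℕ
    x = proj₁ target

    window : ℕ → Bool
    window d = adj R x (emb embedding (P ℤ.- + d))

    profile′ : ℕ → Bool
    profile′ = override (level + level) (L′ + level) window profile

    agree : ∀ {i j} → i ∈ dom embedding → j ∈ dom embedding → profile (dist i j) ≡ profile′ (dist i j)
    agree {i} {j} i∈ j∈ = ≡.sym (override-below (dist-bounded i j (dom-bounded i∈) (dom-bounded j∈)))

    retargeted : PartialEmbedding profile′
    retargeted = retarget embedding agree

    x-placement : Placement retargeted P
    x-placement = record { vertex = x ; fresh = proj₁ (proj₂ target) ; adj-vertex = adj-x }
      where
      adj-x : ∀ {q} → q ∈ dom embedding → adj R x (emb embedding q) ≡ profile′ (dist P q)
      adj-x {q} q∈ = ≡.sym (begin
        profile′ (dist P q)                         ≡⟨ override-inside far near ⟩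
        adj R x (emb embedding (P ℤ.- + dist P q))  ≡⟨ cong (λ i → adj R x (emb embedding i)) (dist-inverse L′ q ∣q∣≤L′) ⟩
        adj R x (emb embedding q)                   ∎)
        where
        far : level + level < dist P q
        far = ℕ.+-cancelʳ-≤ level _ _ (dist-far L′ q (dom-bounded q∈))
        near : dist P q ≤ L′ + level
        near = dist-near L′ q (dom-bounded q∈)
        ∣q∣≤L′ : ∣ q ∣ ≤ L′
        ∣q∣≤L′ = ℕ.≤-trans (dom-bounded q∈) (≤-next-level level)

    profile′-0 : profile′ 0 ≡ false
    profile′-0 = trans (override-below {level + level} {L′ + level} {window} {profile} z≤n) (profile-0 embedding (dom-covers {0ℤ} z≤n))

    P∉ : P ∉ dom embedding
    P∉ P∈ = ℕ.<⇒≱ (<-next-level level) (dom-bounded P∈)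

    extended : PartialEmbedding profile′
    extended = extend retargeted profile′-0 P∉ x-placement

    extended-bounded : ∀ {q} → q ∈ dom extended → ∣ q ∣ ≤ L′
    extended-bounded (here refl) = ℕ.≤-refl
    extended-bounded (there q∈)  = ℕ.≤-trans (dom-bounded q∈) (≤-next-level level)

    profile′-vanishes : ∀ {d} → L′ + L′ < d → profile′ d ≡ false
    profile′-vanishes h = trans (override-above (ℕ.≤-<-trans (ℕ.+-monoʳ-≤ L′ (≤-next-level level)) h))
      (profile-vanishes (ℕ.≤-<-trans (ℕ.+-mono-≤ (≤-next-level level) (≤-next-level level)) h))

    next : Stage
    next = close L′ extended profile′-0 profile′-vanishes extended-bounded

    next-⊒ : embedding ⊑ Stage.embedding next
    next-⊒ = ⊑-trans (retarget-⊒ embedding agree)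
               (⊑-trans (extend-⊒ retargeted profile′-0 P∉ x-placement) (close-⊒ L′ extended profile′-0 profile′-vanishes extended-bounded))

    next-profile-low : ∀ {d} → d ≤ level + level → Stage.profile next d ≡ profile d
    next-profile-low = override-below

    next-profile-high : ∀ {d} → L′ + level < d → Stage.profile next d ≡ false
    next-profile-high h = trans (override-above h)
      (profile-vanishes (ℕ.≤-<-trans (ℕ.+-monoˡ-≤ level (≤-next-level level)) h))

    next-places : s ∈ image (Stage.embedding next)
    next-places with proj₂ (proj₂ target)
    ... | inj₁ s∈ = ⊑-image next-⊒ s∈
    ... | inj₂ x≡s = subst (_∈ image (Stage.embedding next)) x≡s
                       (⊑-image (close-⊒ L′ extended profile′-0 profile′-vanishes extended-bounded)
                                (extend-places retargeted profile′-0 P∉ x-placement))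

  stage : ℕ → Stage
  stage zero    = initial
  stage (suc s) = Step.next s (stage s)

  private
    L : ℕ → ℕ
    L s = Stage.level (stage s)

    T : ℕ → ℕ → Bool
    T s = Stage.profile (stage s)

    E : (s : ℕ) → PartialEmbedding (T s)
    E s = Stage.embedding (stage s)

  ≤-level : ∀ s → s ≤ L s
  ≤-level zero    = z≤n
  ≤-level (suc s) = ℕ.≤-trans (s≤s (≤-level s)) (<-next-level (L s))

  level-mono : ∀ {s t} → s ≤′ t → L s ≤ L t
  level-mono ≤′-refl      = ℕ.≤-refl
  level-mono (≤′-step s≤t) = ℕ.≤-trans (level-mono s≤t) (≤-next-level _)

  stage-⊑ : ∀ {s t} → s ≤′ t → E s ⊑ E t
  stage-⊑ ≤′-refl               = ⊑-refl
  stage-⊑ {s} (≤′-step {t} s≤t) = ⊑-trans (stage-⊑ s≤t) (Step.next-⊒ t (stage t))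

  profile-stable : ∀ {s t d} → s ≤′ t → d ≤ L s + L s → T t d ≡ T s d
  profile-stable ≤′-refl             _ = refl
  profile-stable (≤′-step {t} s≤t) d≤ = trans
    (Step.next-profile-low t (stage t) (ℕ.≤-trans d≤ (ℕ.+-mono-≤ (level-mono s≤t) (level-mono s≤t))))
    (profile-stable s≤t d≤)

  ∈-dom : ∀ s {i} → ∣ i ∣ ≤ s → i ∈ dom (E s)
  ∈-dom s ∣i∣≤s = Stage.dom-covers (stage s) (ℕ.≤-trans ∣i∣≤s (≤-level s))

  emb-agree : ∀ s t {i} → i ∈ dom (E s) → i ∈ dom (E t) → emb (E s) i ≡ emb (E t) i
  emb-agree s t i∈s i∈t with ℕ.≤-total s t
  ... | inj₁ s≤t = ≡.sym (emb-≡ (stage-⊑ (ℕ.≤⇒≤′ s≤t)) i∈s)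
  ... | inj₂ t≤s = emb-≡ (stage-⊑ (ℕ.≤⇒≤′ t≤s)) i∈t

  enum : ℤ → ℕ
  enum i = emb (E ∣ i ∣) i

  enum-at : ∀ t {i} → i ∈ dom (E t) → enum i ≡ emb (E t) i
  enum-at t {i} = emb-agree ∣ i ∣ t (∈-dom ∣ i ∣ ℕ.≤-refl)

  profile∞ : ℕ → Bool
  profile∞ d = T d d

  profile-settles : ∀ {t d} → d ≤ t → T t d ≡ profile∞ d
  profile-settles {d = d} d≤t = profile-stable (ℕ.≤⇒≤′ d≤t) (ℕ.≤-trans (≤-level d) (ℕ.m≤m+n (L d) (L d)))

  adj-enum : ∀ i j → adj R (enum i) (enum j) ≡ profile∞ (dist i j)
  adj-enum i j = begin
    adj R (enum i) (enum j)           ≡⟨ cong₂ (adj R) (enum-at t i∈) (enum-at t j∈) ⟩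
    adj R (emb (E t) i) (emb (E t) j) ≡⟨ adj-emb (E t) i∈ j∈ ⟩
    T t (dist i j)                    ≡⟨ profile-settles (ℤ.∣i-j∣≤∣i∣+∣j∣ i j) ⟩
    profile∞ (dist i j)               ∎
    where
    open ≡-Reasoning
    t = ∣ i ∣ + ∣ j ∣
    i∈ = ∈-dom t (ℕ.m≤m+n ∣ i ∣ ∣ j ∣)
    j∈ = ∈-dom t (ℕ.m≤n+m ∣ j ∣ ∣ i ∣)

  enum-injective : ∀ {i j} → enum i ≡ enum j → i ≡ j
  enum-injective {i} {j} e = emb-injective (E t) i∈ j∈ (trans (≡.sym (enum-at t i∈)) (trans e (enum-at t j∈)))
    where
    t = ∣ i ∣ + ∣ j ∣
    i∈ = ∈-dom t (ℕ.m≤m+n ∣ i ∣ ∣ j ∣)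
    j∈ = ∈-dom t (ℕ.m≤n+m ∣ j ∣ ∣ i ∣)

  private
    placed : ∀ y → ∃ λ i → i ∈ dom (E (suc y)) × y ≡ emb (E (suc y)) i
    placed y = ∈-map⁻ (emb (E (suc y))) (Step.next-places y (stage y))

  index : ℕ → ℤ
  index y = proj₁ (placed y)

  enum-index : ∀ y → enum (index y) ≡ y
  enum-index y = trans (enum-at (suc y) (proj₁ (proj₂ (placed y)))) (≡.sym (proj₂ (proj₂ (placed y))))

  enumeration : DistanceEnumeration R
  enumeration = record
    { enum       = enum
    ; index      = index
    ; enum-index = enum-index
    ; index-enum = λ i → enum-injective (enum-index (enum i))
    ; profile    = profile∞
    ; adj-enum   = adj-enum
    }

  profile∞-has-long-gaps : HasLongGaps profile∞
  profile∞-has-long-gaps w = suc (L (suc w) + L w) , gap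
    where
    open ≡-Reasoning
    L′ = L (suc w)
    gap : ∀ {d} → suc (L′ + L w) ≤ d → d ≤ w + suc (L′ + L w) → profile∞ d ≡ false
    gap {d} c≤d d≤w+c = begin
      profile∞ d         ≡⟨ profile-settles (ℕ.m≤m+n d (suc w)) ⟨
      T (d + suc w) d    ≡⟨ profile-stable (ℕ.≤⇒≤′ (ℕ.m≤n+m (suc w) d)) d≤L′+L′ ⟩
      T (suc w) d        ≡⟨ Step.next-profile-high w (stage w) c≤d ⟩
      false              ∎
      where
      d≤L′+L′ : d ≤ L′ + L′
      d≤L′+L′ = ℕ.≤-trans d≤w+c (ℕ.≤-trans (ℕ.+-monoˡ-≤ _ (ℕ.≤-trans (≤-level w) (ℕ.m≤m+n (L w) (L w))))
                                             (ℕ.≤-reflexive (next-level-double (L w))))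

random-graph-enumeration : (R : Graph) → IsRandom R →
  Σ (DistanceEnumeration R) (HasLongGaps ∘ DistanceEnumeration.profile)
random-graph-enumeration R random = enumeration , profile∞-has-long-gaps
  where open Construction R random

mainTheorem19 : (R : Graph) → IsRandom R →
    ∃ λ (g : Automorphism R) → IsTransitive g ×
      ((A : List ℕ) → ∃ λ (n : ℕ) →
        ∀ a b → a ∈ A → b ∈ map (pow g (+ n)) A → adj R a b ≡ false)
mainTheorem19 R random with random-graph-enumeration R random
... | E , gaps = shift , shift-transitive , shift-separates gaps
  where open Shift E
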